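{- Let $P\ge5$ be a prime and $\rho=P/\log P$. For each prime $p$ define $\alpha_p=0$ if $p>P$; $\alpha_p=1$ if $p\le P$ and $\rho<\frac{p^2-p}{\log p}$; and $\alpha_p=i$ (with $i\ge2$) if $p\le P$ and $\frac{p^i-p^{i-1}}{\log p}\le\rho<\frac{p^{i+1}-p^i}{\log p}$. Let $N_P=\prod_{p\le P}p^{\alpha_p}$ and $n_P=\sum_{p\le P}p^{\alpha_p}$. Then $g(n_P)=N_P$ and \[ \theta(P)\le\log N_P=\log g(n_P)\le\psi(P). \]
   Context: $g(n)$ is Landau's function: $g(n)=\max\{M : \ell(M)\le n\}$ where $\ell$ is additive on coprime factors with $\ell(p^\alpha)=p^\alpha$ ($p$ prime, $\alpha\ge1$), $\ell(1)=0$ (equivalently the maximal order of an element of $\mathfrak{S}_n$). Chebyshev functions: $\theta(x)=\sum_{p\le x}\log p$ and $\psi(x)=\sum_{p^m\le x,\,m\ge1}\log p$ (sums over primes $p$). -}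

module Defs where

open import Data.Nat using (ℕ; zero; suc; _+_; _*_; _∸_; _^_; _≤_; _<_; _⊔_; _≤?_)
open import Data.Nat.Divisibility using (_∣_; _∣?_)
open import Data.Nat.Primality using (Prime; prime?)
open import Data.List using (List; upTo; filter; map; foldr; length)
open import Data.Nat.ListAction using (sum; product)
open import Data.Product using (_×_)
open import Data.Sum using (_⊎_)
open import Relation.Nullary.Decidable using (does)
open import Data.Bool using (if_then_else_)
open import Relation.Binary.PropositionalEquality using (_≡_)

primesUpTo : ℕ → List ℕ
primesUpTo x = filter prime? (upTo (suc x))

-- largest power of p dividing M (for M ≥ 1, p ≥ 2); p^k with k ≤ M suffices
ppart : ℕ → ℕ → ℕ
ppart p M = foldr _⊔_ 1
  (map (λ k → if does (p ^ k ∣? M) then p ^ k else 1) (upTo (suc M)))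

-- ℓ(M) = Σ_{p^a ∥ M} p^a  (additive on coprime factors, ℓ(p^a) = p^a, ℓ(1) = 0)
ℓ : ℕ → ℕ
ℓ M = sum (map (ppart' M) (filter prime? (upTo (suc M))))
  where
  ppart' : ℕ → ℕ → ℕ
  ppart' M p = if does (p ∣? M) then ppart p M else 0

-- Landau's function: g n ≡ N  unfolded as  N = max { M : ℓ(M) ≤ n }
IsLandauValue : ℕ → ℕ → Set
IsLandauValue n N = ℓ N ≤ n × ((M : ℕ) → ℓ M ≤ n → M ≤ N)

-- The defining condition of α_p for a prime p ≤ P (with ρ = P / log P),
-- exponentiated: (a/log p) vs (P/log P)  ⇔  P^a vs p^P  (all logs positive).
--   α_p = 1      iff  ρ < (p²-p)/log p
--   α_p = i ≥ 2  iff  (p^i - p^(i-1))/log p ≤ ρ < (p^(i+1) - p^i)/log p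
IsAlpha : ℕ → ℕ → ℕ → Set
IsAlpha P p i =
  (i ≡ 1 × p ^ P < P ^ (p ^ 2 ∸ p))
  ⊎ (2 ≤ i × P ^ (p ^ i ∸ p ^ (i ∸ 1)) ≤ p ^ P × p ^ P < P ^ (p ^ suc i ∸ p ^ i))

NP : ℕ → (ℕ → ℕ) → ℕ
NP P α = product (map (λ p → p ^ α p) (primesUpTo P))

nP : ℕ → (ℕ → ℕ) → ℕ
nP P α = sum (map (λ p → p ^ α p) (primesUpTo P))

expθ : ℕ → ℕ
expθ x = product (primesUpTo x)

-- exp ψ(x) = ∏_{p^m ≤ x, m ≥ 1} p = ∏_{p ≤ x} p^{#{m ≥ 1 : p^m ≤ x}}
-- (m ranges over 1..x, which suffices since p^m ≥ 2^m > m)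
expψ : ℕ → ℕ
expψ x = product (map (λ p → p ^ cnt p) (primesUpTo x))
  where
  cnt : ℕ → ℕ
  cnt p = length (filter (λ m → p ^ suc m ≤? x) (upTo x))

-- For a prime p write ℓ(p^k) for its contribution to ℓ (0 when k = 0) and Δ_j = ℓ(p^(j+1)) − ℓ(p^j);
-- these increments are nondecreasing in j. Exponentiated, the definition of α_p says exactly that
-- P^Δ_j ≤ p^P for j < α_p and p^P ≤ P^Δ_j for j ≥ α_p, and with α_p = 0 the latter also holds for
-- p > P because p^P < P^p. Telescoping these inequalities between α_p and any exponent e gives
-- (p^P)^e P^ℓ(p^α_p) ≤ (p^P)^α_p P^ℓ(p^e); multiplying over all p with e = ν_p(M) yields
-- M^P P^n_P ≤ N_P^P P^ℓ(M), so ℓ(M) ≤ n_P forces M ≤ N_P, while ℓ(N_P) = n_P by construction.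
-- Finally α_p ≥ 1 gives θ(P) ≤ log N_P, and p^α_p ≤ P gives log N_P ≤ ψ(P).
{-# OPTIONS --safe #-}
module Submission where

open import Data.Bool using (if_then_else_; true; false)
open import Data.List using (List; []; _∷_; _++_; [_]; upTo; filter; map; foldr; length)
open import Data.List.Membership.Propositional using (_∈_)
open import Data.List.Membership.Propositional.Properties
  using (∈-upTo⁺; ∈-upTo⁻; ∈-filter⁺; ∈-filter⁻; ∈-++⁻; ∈-map⁺)
open import Data.List.Properties
  using (filter-++; filter-accept; filter-reject; upTo-∷ʳ; ++-assoc; ++-identityʳ; length-++
        ; map-++; map-cong; map-cong-local; map-id)
open import Data.List.Relation.Binary.Permutation.Propositional using (_↭_)
import Data.List.Relation.Binary.Permutation.Propositional.Properties as ↭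
open import Data.List.Relation.Unary.All as All using (_∷_)
open import Data.List.Relation.Unary.Any using (here; there)
open import Data.Nat
open import Data.Nat.Divisibility
open import Data.Nat.ListAction using (sum; product)
open import Data.Nat.ListAction.Properties using (sum-++; product-++; product-↭; ∈⇒∣product)
open import Data.Nat.Primality
open import Data.Nat.Primality.Factorisation using (factorise)
open import Data.Nat.Properties
open import Data.Nat.Solver using (module +-*-Solver)
open +-*-Solver using (solve; _:=_; _:+_; _:*_; con)
open import Algebra.Properties.CommutativeSemigroup *-commutativeSemigroup using (x∙yz≈y∙xz)
open import Data.Product using (_×_; _,_; proj₁; proj₂; uncurry; ∃-syntax)
open import Data.Sum using (_⊎_; inj₁; inj₂)
open import Function using (_∘_)
open import Relation.Binary.PropositionalEquality hiding ([_])
open import Relation.Nullary using (¬_; Dec; yes; no; does; contradiction)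

open import Defs

private variable
  f g : ℕ → ℕ
  xs : List ℕ
  j k m n p q X Y : ℕ

^-distribʳ-* : ∀ m n k → (m * n) ^ k ≡ m ^ k * n ^ k
^-distribʳ-* m n zero = refl
^-distribʳ-* m n (suc k) = begin
  m * n * (m * n) ^ k     ≡⟨ cong (m * n *_) (^-distribʳ-* m n k) ⟩
  m * n * (m ^ k * n ^ k) ≡⟨ [m*n]*[o*p]≡[m*o]*[n*p] m n (m ^ k) (n ^ k) ⟩
  m * m ^ k * (n * n ^ k) ∎
  where open ≡-Reasoning

^-comm-^ : ∀ m j k → (m ^ j) ^ k ≡ (m ^ k) ^ j
^-comm-^ m j k = begin
  (m ^ j) ^ k ≡⟨ ^-*-assoc m j k ⟩
  m ^ (j * k) ≡⟨ cong (m ^_) (*-comm j k) ⟩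
  m ^ (k * j) ≡⟨ ^-*-assoc m k j ⟨
  (m ^ k) ^ j ∎
  where open ≡-Reasoning

^-monoʳ-∣ : ∀ m {j k} → j ≤ k → m ^ j ∣ m ^ k
^-monoʳ-∣ m {j} {k} j≤k = divides (m ^ (k ∸ j))
  (trans (cong (m ^_) (sym (m∸n+n≡m j≤k))) (^-distribˡ-+-* m (k ∸ j) j))

^-cancelʳ-< : ∀ k → m ^ k < n ^ k → m < n
^-cancelʳ-< {m} {n} k mᵏ<nᵏ with m <? n
... | yes m<n = m<n
... | no  m≮n = contradiction mᵏ<nᵏ (≤⇒≯ (^-monoˡ-≤ k (≮⇒≥ m≮n)))

^-cancelʳ-≤ : ∀ k .{{_ : NonZero k}} → m ^ k ≤ n ^ k → m ≤ n
^-cancelʳ-≤ {m} {n} k mᵏ≤nᵏ with m ≤? n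
... | yes m≤n = m≤n
... | no  m≰n = contradiction mᵏ≤nᵏ (<⇒≱ (^-monoˡ-< k (≰⇒> m≰n)))

n<m^n : ∀ m n → 2 ≤ m → n < m ^ n
n<m^n m zero    2≤m = s≤s z≤n
n<m^n m (suc n) 2≤m = begin-strict
  suc n         ≤⟨ ih ⟩
  m ^ n         <⟨ m<m+n (m ^ n) (≤-trans (s≤s z≤n) ih) ⟩
  m ^ n + m ^ n ≡⟨ cong (m ^ n +_) (+-identityʳ (m ^ n)) ⟨
  2 * m ^ n     ≤⟨ *-monoˡ-≤ (m ^ n) 2≤m ⟩
  m * m ^ n     ∎
  where
  open ≤-Reasoning
  ih = n<m^n m n 2≤m

[1+n]^k*r≤n^[1+k] : ∀ n k r → k + r ≡ n → suc n ^ k * r ≤ n ^ suc k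
[1+n]^k*r≤n^[1+k] n zero    r r≡n = subst₂ _≤_ (sym (+-identityʳ r)) (sym (*-identityʳ n)) (≤-reflexive r≡n)
[1+n]^k*r≤n^[1+k] n (suc k) r k+1+r≡n = *-cancelʳ-≤ (suc n ^ suc k * r) (n ^ suc (suc k)) (suc r) (begin
  suc n * A * r * suc r     ≡⟨ solve 4 (λ s a r′ t → s :* a :* r′ :* t := (a :* t) :* (s :* r′)) refl (suc n) A r (suc r) ⟩
  A * suc r * (suc n * r)   ≤⟨ *-monoˡ-≤ (suc n * r) ih ⟩
  B * (suc n * r)           ≤⟨ *-monoʳ-≤ B [1+n]r≤n[1+r] ⟩
  B * (n * suc r)           ≡⟨ solve 3 (λ b n′ t → b :* (n′ :* t) := n′ :* b :* t) refl B n (suc r) ⟩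
  n * B * suc r             ∎)
  where
  open ≤-Reasoning
  A = suc n ^ k
  B = n ^ suc k
  ih : A * suc r ≤ B
  ih = [1+n]^k*r≤n^[1+k] n k (suc r) (trans (+-suc k r) k+1+r≡n)
  [1+n]r≤n[1+r] : suc n * r ≤ n * suc r
  [1+n]r≤n[1+r] = subst (suc n * r ≤_) (sym (*-suc n r))
    (+-monoˡ-≤ (n * r) (subst (r ≤_) k+1+r≡n (m≤n+m r (suc k))))

-- The previous lemma with k = n − 2 and r = 2, together with (n + 1)² < 2n² for n ≥ 3.
[1+n]^n<n^[1+n] : ∀ n → 3 ≤ n → suc n ^ n < n ^ suc n
[1+n]^n<n^[1+n] 0 ()
[1+n]^n<n^[1+n] 1 (s≤s ())
[1+n]^n<n^[1+n] 2 (s≤s (s≤s ()))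
[1+n]^n<n^[1+n] n@(suc (suc (suc m))) _ = *-cancelˡ-< 2 _ _ (begin-strict
  2 * (suc n * (suc n * A))  ≡⟨ solve 2 (λ s a → con 2 :* (s :* (s :* a)) := (a :* con 2) :* (s :* s)) refl (suc n) A ⟩
  A * 2 * (suc n * suc n)    ≤⟨ *-monoˡ-≤ _ A*2≤B ⟩
  B * (suc n * suc n)        <⟨ *-monoʳ-< B {{m^n≢0 n (suc (suc m))}} [1+n]²<2n² ⟩
  B * (2 * (n * n))          ≡⟨ solve 2 (λ b n′ → b :* (con 2 :* (n′ :* n′)) := con 2 :* (n′ :* (n′ :* b))) refl B n ⟩
  2 * (n * (n * B))          ∎)
  where
  open ≤-Reasoning
  A = suc n ^ suc m
  B = n ^ suc (suc m)
  A*2≤B : A * 2 ≤ B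
  A*2≤B = [1+n]^k*r≤n^[1+k] n (suc m) 2 (solve 1 (λ m′ → con 1 :+ m′ :+ con 2 := con 3 :+ m′) refl m)
  [1+n]²<2n² : suc n * suc n < 2 * (n * n)
  [1+n]²<2n² = subst (suc n * suc n <_)
    (solve 1 (λ m′ → (con 4 :+ m′) :* (con 4 :+ m′) :+ (m′ :* m′ :+ con 4 :* m′ :+ con 2)
                      := con 2 :* ((con 3 :+ m′) :* (con 3 :+ m′))) refl m)
    (m<m+n (suc n * suc n) {m * m + 4 * m + 2} (subst (0 <_) (+-comm 2 (m * m + 4 * m)) z<s))

-- Induction on n: raising c^m < m^c and (c + 1)^c < c^(c + 1) to suitable powers
-- gives ((c + 1)^m)^c < (m^(c + 1))^c.
n^m<m^n : ∀ m n → 3 ≤ m → m < n → n ^ m < m ^ n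
n^m<m^n m n 3≤m m<n = subst (λ n → n ^ m < m ^ n) (m∸n+n≡m m<n) (shifted (n ∸ suc m))
  where
  instance _ = >-nonZero (<-trans z<s 3≤m)
  shifted : ∀ d → (d + suc m) ^ m < m ^ (d + suc m)
  shifted zero    = [1+n]^n<n^[1+n] m 3≤m
  shifted (suc d) = ^-cancelʳ-< c (begin-strict
    (suc c ^ m) ^ c ≡⟨ ^-comm-^ (suc c) m c ⟩
    (suc c ^ c) ^ m <⟨ ^-monoˡ-< m ([1+n]^n<n^[1+n] c (≤-trans 3≤m (≤-trans (n≤1+n m) (m≤n+m (suc m) d)))) ⟩
    (c ^ suc c) ^ m ≡⟨ ^-comm-^ c (suc c) m ⟩
    (c ^ m) ^ suc c <⟨ ^-monoˡ-< (suc c) (shifted d) ⟩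
    (m ^ c) ^ suc c ≡⟨ ^-comm-^ m c (suc c) ⟩
    (m ^ suc c) ^ c ∎)
    where
    open ≤-Reasoning
    c = d + suc m

n^2≤2^n : ∀ n → 4 ≤ n → n ^ 2 ≤ 2 ^ n
n^2≤2^n n 4≤n = subst (λ n → n ^ 2 ≤ 2 ^ n) (m+[n∸m]≡n 4≤n)
  (subst (_≤ 2 ^ (4 + (n ∸ 4))) (cong ((4 + (n ∸ 4)) *_) (sym (*-identityʳ (4 + (n ∸ 4))))) (shifted (n ∸ 4)))
  where
  shifted : ∀ m → (4 + m) * (4 + m) ≤ 2 ^ (4 + m)
  shifted zero    = ≤-refl
  shifted (suc m) = begin
    (5 + m) * (5 + m)
      ≡⟨ solve 1 (λ m′ → (con 5 :+ m′) :* (con 5 :+ m′) := (con 4 :+ m′) :* (con 4 :+ m′) :+ (con 9 :+ con 2 :* m′)) refl m ⟩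
    (4 + m) * (4 + m) + (9 + 2 * m)
      ≤⟨ +-monoʳ-≤ ((4 + m) * (4 + m)) 9+2m≤[4+m]² ⟩
    (4 + m) * (4 + m) + (4 + m) * (4 + m)
      ≤⟨ +-mono-≤ (shifted m) (shifted m) ⟩
    2 ^ (4 + m) + 2 ^ (4 + m)
      ≡⟨ cong (2 ^ (4 + m) +_) (+-identityʳ _) ⟨
    2 ^ (5 + m)
      ∎
    where
    open ≤-Reasoning
    9+2m≤[4+m]² : 9 + 2 * m ≤ (4 + m) * (4 + m)
    9+2m≤[4+m]² = subst (9 + 2 * m ≤_)
      (solve 1 (λ m′ → con 9 :+ con 2 :* m′ :+ (con 7 :+ con 6 :* m′ :+ m′ :* m′) := (con 4 :+ m′) :* (con 4 :+ m′)) refl m)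
      (m≤m+n (9 + 2 * m) (7 + 6 * m + m * m))

n^m≤m^n : ∀ m n → 2 ≤ m → m ≤ n → 4 ≤ n → n ^ m ≤ m ^ n
n^m≤m^n m n 2≤m m≤n 4≤n with m≤n⇒m<n∨m≡n m≤n | m≤n⇒m<n∨m≡n 2≤m
... | inj₂ refl | _         = ≤-refl
... | inj₁ m<n  | inj₁ 3≤m  = <⇒≤ (n^m<m^n m n 3≤m m<n)
... | inj₁ m<n  | inj₂ refl = n^2≤2^n n 4≤n

-- A discrete convexity argument: g e / Q ^ e is maximal at e = a.
module _ (Q : ℕ) (g : ℕ → ℕ) where

  growth-≤ : ∀ b k → (∀ j → j < k + b → g (suc j) ≤ Q * g j) → g (k + b) ≤ Q ^ k * g b
  growth-≤ b zero    _    = ≤-reflexive (sym (*-identityˡ (g b)))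
  growth-≤ b (suc k) slow = begin
    g (suc (k + b))   ≤⟨ slow (k + b) ≤-refl ⟩
    Q * g (k + b)     ≤⟨ *-monoʳ-≤ Q (growth-≤ b k (λ j j<k+b → slow j (m≤n⇒m≤1+n j<k+b))) ⟩
    Q * (Q ^ k * g b) ≡⟨ *-assoc Q (Q ^ k) (g b) ⟨
    Q ^ suc k * g b   ∎
    where open ≤-Reasoning

  growth-≥ : ∀ b k → (∀ j → b ≤ j → Q * g j ≤ g (suc j)) → Q ^ k * g b ≤ g (k + b)
  growth-≥ b zero    _    = ≤-reflexive (*-identityˡ (g b))
  growth-≥ b (suc k) fast = begin
    Q ^ suc k * g b   ≡⟨ *-assoc Q (Q ^ k) (g b) ⟩
    Q * (Q ^ k * g b) ≤⟨ *-monoʳ-≤ Q (growth-≥ b k fast) ⟩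
    Q * g (k + b)     ≤⟨ fast (k + b) (m≤n+m b k) ⟩
    g (suc (k + b))   ∎
    where open ≤-Reasoning

  exchange : ∀ a b → (∀ j → j < a → g (suc j) ≤ Q * g j) → (∀ j → a ≤ j → Q * g j ≤ g (suc j)) →
    Q ^ b * g a ≤ Q ^ a * g b
  exchange a b slow fast with ≤-total b a
  ... | inj₁ b≤a = subst (λ a → Q ^ b * g a ≤ Q ^ a * g b) (m∸n+n≡m b≤a) (begin
    Q ^ b * g (d + b)         ≤⟨ *-monoʳ-≤ (Q ^ b) (growth-≤ b d (λ j j<a → slow j (subst (j <_) (m∸n+n≡m b≤a) j<a))) ⟩
    Q ^ b * (Q ^ d * g b)     ≡⟨ x∙yz≈y∙xz (Q ^ b) (Q ^ d) (g b) ⟩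
    Q ^ d * (Q ^ b * g b)     ≡⟨ *-assoc (Q ^ d) (Q ^ b) (g b) ⟨
    Q ^ d * Q ^ b * g b       ≡⟨ cong (_* g b) (^-distribˡ-+-* Q d b) ⟨
    Q ^ (d + b) * g b         ∎)
    where
    open ≤-Reasoning
    d = a ∸ b
  ... | inj₂ a≤b = subst (λ b → Q ^ b * g a ≤ Q ^ a * g b) (m∸n+n≡m a≤b) (begin
    Q ^ (d + a) * g a         ≡⟨ cong (_* g a) (^-distribˡ-+-* Q d a) ⟩
    Q ^ d * Q ^ a * g a       ≡⟨ *-assoc (Q ^ d) (Q ^ a) (g a) ⟩
    Q ^ d * (Q ^ a * g a)     ≡⟨ x∙yz≈y∙xz (Q ^ d) (Q ^ a) (g a) ⟩
    Q ^ a * (Q ^ d * g a)     ≤⟨ *-monoʳ-≤ (Q ^ a) (growth-≥ a d fast) ⟩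
    Q ^ a * g (d + a)         ∎)
    where
    open ≤-Reasoning
    d = b ∸ a

map-cong-∈ : (∀ {x} → x ∈ xs → f x ≡ g x) → map f xs ≡ map g xs
map-cong-∈ f≡g = map-cong-local (All.tabulate f≡g)

product-map-mono-≤ : (∀ {x} → x ∈ xs → f x ≤ g x) → product (map f xs) ≤ product (map g xs)
product-map-mono-≤ {xs = []}     f≤g = ≤-refl
product-map-mono-≤ {xs = x ∷ xs} f≤g = *-mono-≤ (f≤g (here refl)) (product-map-mono-≤ (f≤g ∘ there))

product-map-≡1 : (∀ {x} → x ∈ xs → f x ≡ 1) → product (map f xs) ≡ 1
product-map-≡1 {xs = []}     f≡1 = refl
product-map-≡1 {xs = x ∷ xs} f≡1 = cong₂ _*_ (f≡1 (here refl)) (product-map-≡1 (f≡1 ∘ there))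

sum-map-≡0 : (∀ {x} → x ∈ xs → f x ≡ 0) → sum (map f xs) ≡ 0
sum-map-≡0 {xs = []}     f≡0 = refl
sum-map-≡0 {xs = x ∷ xs} f≡0 = cong₂ _+_ (f≡0 (here refl)) (sum-map-≡0 (f≡0 ∘ there))

product-map-nonZero : (∀ {x} → x ∈ xs → NonZero (f x)) → NonZero (product (map f xs))
product-map-nonZero {xs = []}     f≢0 = _
product-map-nonZero {xs = x ∷ xs} f≢0 =
  m*n≢0 _ _ {{f≢0 (here refl)}} {{product-map-nonZero (f≢0 ∘ there)}}

product-map-* : ∀ xs → product (map (λ x → f x * g x) xs) ≡ product (map f xs) * product (map g xs)
product-map-*             []       = refl
product-map-* {f} {g} (x ∷ xs) = begin
  f x * g x * product (map (λ x → f x * g x) xs) ≡⟨ cong (f x * g x *_) (product-map-* xs) ⟩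
  f x * g x * (product (map f xs) * product (map g xs)) ≡⟨ [m*n]*[o*p]≡[m*o]*[n*p] (f x) (g x) _ _ ⟩
  f x * product (map f xs) * (g x * product (map g xs)) ∎
  where open ≡-Reasoning

product-map-^ : ∀ k xs → product (map (λ x → f x ^ k) xs) ≡ product (map f xs) ^ k
product-map-^         k []       = sym (^-zeroˡ k)
product-map-^ {f} k (x ∷ xs) = begin
  f x ^ k * product (map (λ x → f x ^ k) xs) ≡⟨ cong (f x ^ k *_) (product-map-^ k xs) ⟩
  f x ^ k * product (map f xs) ^ k            ≡⟨ ^-distribʳ-* (f x) _ k ⟨
  (f x * product (map f xs)) ^ k              ∎
  where open ≡-Reasoning

product-map-^ʳ : ∀ b xs → product (map (λ x → b ^ f x) xs) ≡ b ^ sum (map f xs)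
product-map-^ʳ         b []       = refl
product-map-^ʳ {f} b (x ∷ xs) = begin
  b ^ f x * product (map (λ x → b ^ f x) xs) ≡⟨ cong (b ^ f x *_) (product-map-^ʳ b xs) ⟩
  b ^ f x * b ^ sum (map f xs)                ≡⟨ ^-distribˡ-+-* b (f x) _ ⟨
  b ^ (f x + sum (map f xs))                  ∎
  where open ≡-Reasoning

≤length-filter-upTo : ∀ {a} {Q : ℕ → Set a} (Q? : ∀ m → Dec (Q m)) →
  k ≤ n → (∀ m → m < k → Q m) → k ≤ length (filter Q? (upTo n))
≤length-filter-upTo {k} {zero} Q? z≤n _ = z≤n
≤length-filter-upTo {k} {suc n} Q? k≤1+n all<k = subst (k ≤_) (sym count-suc) (count≥ (m≤n⇒m<n∨m≡n k≤1+n))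
  where
  count-suc : length (filter Q? (upTo (suc n))) ≡ length (filter Q? (upTo n)) + length (filter Q? [ n ])
  count-suc = begin
    length (filter Q? (upTo (suc n)))                      ≡⟨ cong (length ∘ filter Q?) (upTo-∷ʳ n) ⟨
    length (filter Q? (upTo n ++ [ n ]))                   ≡⟨ cong length (filter-++ Q? (upTo n) [ n ]) ⟩
    length (filter Q? (upTo n) ++ filter Q? [ n ])         ≡⟨ length-++ (filter Q? (upTo n)) ⟩
    length (filter Q? (upTo n)) + length (filter Q? [ n ]) ∎
    where open ≡-Reasoning
  count≥ : k < suc n ⊎ k ≡ suc n → k ≤ length (filter Q? (upTo n)) + length (filter Q? [ n ])
  count≥ (inj₁ k<1+n) = ≤-trans (≤length-filter-upTo Q? (≤-pred k<1+n) all<k) (m≤m+n _ _)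
  count≥ (inj₂ refl)  = subst (λ xs → suc n ≤ length (filter Q? (upTo n)) + length xs)
    (sym (filter-accept Q? (all<k n ≤-refl)))
    (subst (suc n ≤_) (+-comm 1 _) (s≤s (≤length-filter-upTo Q? ≤-refl (λ m m<n → all<k m (m≤n⇒m≤1+n m<n)))))

prime⇒2≤ : Prime p → 2 ≤ p
prime⇒2≤ {p} pr = nonTrivial⇒n>1 p {{prime⇒nonTrivial pr}}

prime∣product-map : Prime p → p ∣ product (map f xs) → ∃[ x ] x ∈ xs × p ∣ f x
prime∣product-map {xs = []}     pr p∣1 = contradiction (∣1⇒≡1 p∣1) (>⇒≢ (prime⇒2≤ pr))
prime∣product-map {f = f} {xs = x ∷ xs} pr p∣ with euclidsLemma (f x) _ pr p∣
... | inj₁ p∣fx = x , here refl , p∣fx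
... | inj₂ p∣rest with prime∣product-map pr p∣rest
...   | y , y∈xs , p∣fy = y , there y∈xs , p∣fy

prime∣prime^⇒≡ : ∀ k → Prime p → Prime q → p ∣ q ^ k → p ≡ q
prime∣prime^⇒≡ zero    prp prq p∣1 = contradiction (∣1⇒≡1 p∣1) (>⇒≢ (prime⇒2≤ prp))
prime∣prime^⇒≡ {q = q} (suc k) prp prq p∣ with euclidsLemma q (q ^ k) prp p∣
... | inj₂ p∣q^k = prime∣prime^⇒≡ k prp prq p∣q^k
... | inj₁ p∣q with prime⇒irreducible prq p∣q
...   | inj₁ p≡1 = contradiction p≡1 (>⇒≢ (prime⇒2≤ prp))
...   | inj₂ p≡q = p≡q

prime^∣*⇒prime^∣ʳ : ∀ k n → Prime p → ¬ p ∣ m → p ^ k ∣ m * n → p ^ k ∣ n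
prime^∣*⇒prime^∣ʳ zero n prp p∤m _ = 1∣ n
prime^∣*⇒prime^∣ʳ {p} {m} (suc k) n prp p∤m p^k+1∣mn
  with euclidsLemma m n prp (∣-trans (m∣m*n (p ^ k)) p^k+1∣mn)
... | inj₁ p∣m = contradiction p∣m p∤m
... | inj₂ (divides n′ refl) =
  subst (p ^ suc k ∣_) (*-comm p n′) (*-monoʳ-∣ p (prime^∣*⇒prime^∣ʳ k n′ prp p∤m p^k∣mn′))
  where
  instance _ = prime⇒nonZero prp
  p^k∣mn′ : p ^ k ∣ m * n′
  p^k∣mn′ = *-cancelˡ-∣ p (subst (p * p ^ k ∣_) (trans (sym (*-assoc m n′ p)) (*-comm (m * n′) p)) p^k+1∣mn)

prime∤∏-prime^ : ∀ (e : ℕ → ℕ) xs → Prime q → (∀ {p} → p ∈ xs → Prime p × p ≢ q) →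
  ¬ q ∣ product (map (λ p → p ^ e p) xs)
prime∤∏-prime^ e xs prq others q∣ with prime∣product-map {xs = xs} prq q∣
... | p , p∈xs , q∣p^e with others p∈xs
...   | prp , p≢q = p≢q (sym (prime∣prime^⇒≡ (e p) prq prp q∣p^e))

∃prime∣ : 2 ≤ n → ∃[ q ] Prime q × q ∣ n
∃prime∣ {n} 2≤n with factorise n {{>-nonZero (<-trans z<s 2≤n)}}
... | record { factors = [] ; isFactorisation = n≡1 } = contradiction n≡1 (>⇒≢ 2≤n)
... | record { factors = q ∷ qs ; isFactorisation = eq ; factorsPrime = prq ∷ _ } =
  q , prq , divides (product qs) (trans eq (*-comm q (product qs)))

∏ₚ : ℕ → (ℕ → ℕ) → ℕ
∏ₚ X f = product (map f (primesUpTo X))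

∑ₚ : ℕ → (ℕ → ℕ) → ℕ
∑ₚ X f = sum (map f (primesUpTo X))

infix 5 ∏ₚ ∑ₚ
syntax ∏ₚ X (λ p → e) = ∏[ p ≤ X ] e
syntax ∑ₚ X (λ p → e) = ∑[ p ≤ X ] e

∈-primesUpTo⁺ : Prime p → p ≤ X → p ∈ primesUpTo X
∈-primesUpTo⁺ pr p≤X = ∈-filter⁺ prime? (∈-upTo⁺ (s≤s p≤X)) pr

∈-primesUpTo⁻ : p ∈ primesUpTo X → Prime p × p ≤ X
∈-primesUpTo⁻ p∈ with ∈-filter⁻ prime? p∈
... | p∈upTo , pr = pr , ≤-pred (∈-upTo⁻ p∈upTo)

primesUpTo-suc : ∀ X → primesUpTo (suc X) ≡ primesUpTo X ++ filter prime? [ suc X ]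
primesUpTo-suc X = begin
  filter prime? (upTo (suc (suc X)))         ≡⟨ cong (filter prime?) (upTo-∷ʳ (suc X)) ⟨
  filter prime? (upTo (suc X) ++ [ suc X ]) ≡⟨ filter-++ prime? (upTo (suc X)) [ suc X ] ⟩
  primesUpTo X ++ filter prime? [ suc X ]    ∎
  where open ≡-Reasoning

primesUpTo-++ : X ≤′ Y →
  ∃[ ps ] primesUpTo Y ≡ primesUpTo X ++ ps × (∀ {p} → p ∈ ps → Prime p × X < p)
primesUpTo-++ {X} ≤′-refl = [] , sym (++-identityʳ (primesUpTo X)) , λ ()
primesUpTo-++ {X} (≤′-step {Y} X≤Y) with primesUpTo-++ X≤Y
... | ps , eq , X<ps = ps ++ new , eq′ , X<ps++new
  where
  new = filter prime? [ suc Y ]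
  eq′ : primesUpTo (suc Y) ≡ primesUpTo X ++ ps ++ new
  eq′ = begin
    primesUpTo (suc Y)          ≡⟨ primesUpTo-suc Y ⟩
    primesUpTo Y ++ new         ≡⟨ cong (_++ new) eq ⟩
    (primesUpTo X ++ ps) ++ new ≡⟨ ++-assoc (primesUpTo X) ps new ⟩
    primesUpTo X ++ ps ++ new   ∎
    where open ≡-Reasoning
  X<ps++new : ∀ {p} → p ∈ ps ++ new → Prime p × X < p
  X<ps++new p∈ with ∈-++⁻ ps p∈
  ... | inj₁ p∈ps = X<ps p∈ps
  ... | inj₂ p∈new with ∈-filter⁻ prime? {xs = [ suc Y ]} p∈new
  ...   | here refl , pr = pr , s≤s (≤′⇒≤ X≤Y)

primesUpTo-pivot : Prime q → q ≤ X →
  ∃[ ps ] primesUpTo X ↭ q ∷ ps × (∀ {p} → p ∈ ps → Prime p × p ≢ q)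
primesUpTo-pivot {q@(suc q′)} {X} pr q≤X with primesUpTo-++ (≤⇒≤′ q≤X)
... | rs , eq , q<rs = primesUpTo q′ ++ rs , perm , others
  where
  perm : primesUpTo X ↭ q ∷ primesUpTo q′ ++ rs
  perm = subst (_↭ q ∷ primesUpTo q′ ++ rs) (sym (begin
    primesUpTo X                                 ≡⟨ eq ⟩
    primesUpTo q ++ rs                           ≡⟨ cong (_++ rs) (primesUpTo-suc q′) ⟩
    (primesUpTo q′ ++ filter prime? [ q ]) ++ rs ≡⟨ cong (λ l → (primesUpTo q′ ++ l) ++ rs) (filter-accept prime? pr) ⟩
    (primesUpTo q′ ++ [ q ]) ++ rs               ≡⟨ ++-assoc (primesUpTo q′) [ q ] rs ⟩
    primesUpTo q′ ++ [ q ] ++ rs                 ∎)) (↭.shift q (primesUpTo q′) rs)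
    where open ≡-Reasoning
  others : ∀ {p} → p ∈ primesUpTo q′ ++ rs → Prime p × p ≢ q
  others p∈ with ∈-++⁻ (primesUpTo q′) p∈
  ... | inj₁ p∈small with ∈-primesUpTo⁻ p∈small
  ...   | prp , p≤q′ = prp , <⇒≢ (s≤s p≤q′)
  others p∈ | inj₂ p∈rs with q<rs p∈rs
  ... | prp , q<p = prp , >⇒≢ q<p

∏ₚ-extend : X ≤ Y → (∀ {p} → Prime p → X < p → f p ≡ 1) → ∏ₚ Y f ≡ ∏ₚ X f
∏ₚ-extend {X} {Y} {f} X≤Y f≡1 with primesUpTo-++ (≤⇒≤′ X≤Y)
... | ps , eq , X<ps = begin
  product (map f (primesUpTo Y))                           ≡⟨ cong (product ∘ map f) eq ⟩
  product (map f (primesUpTo X ++ ps))                     ≡⟨ cong product (map-++ f (primesUpTo X) ps) ⟩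
  product (map f (primesUpTo X) ++ map f ps)               ≡⟨ product-++ (map f (primesUpTo X)) _ ⟩
  ∏ₚ X f * product (map f ps)                              ≡⟨ cong (∏ₚ X f *_) (product-map-≡1 (uncurry f≡1 ∘ X<ps)) ⟩
  ∏ₚ X f * 1                                               ≡⟨ *-identityʳ _ ⟩
  ∏ₚ X f                                                   ∎
  where open ≡-Reasoning

∑ₚ-extend : X ≤ Y → (∀ {p} → Prime p → X < p → f p ≡ 0) → ∑ₚ Y f ≡ ∑ₚ X f
∑ₚ-extend {X} {Y} {f} X≤Y f≡0 with primesUpTo-++ (≤⇒≤′ X≤Y)
... | ps , eq , X<ps = begin
  sum (map f (primesUpTo Y))               ≡⟨ cong (sum ∘ map f) eq ⟩
  sum (map f (primesUpTo X ++ ps))         ≡⟨ cong sum (map-++ f (primesUpTo X) ps) ⟩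
  sum (map f (primesUpTo X) ++ map f ps)   ≡⟨ sum-++ (map f (primesUpTo X)) _ ⟩
  ∑ₚ X f + sum (map f ps)                  ≡⟨ cong (∑ₚ X f +_) (sum-map-≡0 (uncurry f≡0 ∘ X<ps)) ⟩
  ∑ₚ X f + 0                               ≡⟨ +-identityʳ _ ⟩
  ∑ₚ X f                                   ∎
  where open ≡-Reasoning

∏ₚ-suc : ∀ X (f : ℕ → ℕ) → ∏ₚ (suc X) f ≡ ∏ₚ X f * product (map f (filter prime? [ suc X ]))
∏ₚ-suc X f = begin
  product (map f (primesUpTo (suc X)))                              ≡⟨ cong (product ∘ map f) (primesUpTo-suc X) ⟩
  product (map f (primesUpTo X ++ filter prime? [ suc X ]))         ≡⟨ cong product (map-++ f (primesUpTo X) _) ⟩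
  product (map f (primesUpTo X) ++ map f (filter prime? [ suc X ])) ≡⟨ product-++ (map f (primesUpTo X)) _ ⟩
  ∏ₚ X f * product (map f (filter prime? [ suc X ]))                ∎
  where open ≡-Reasoning

∏ₚ-suc-prime : ∀ {X} (f : ℕ → ℕ) → Prime (suc X) → ∏ₚ (suc X) f ≡ ∏ₚ X f * f (suc X)
∏ₚ-suc-prime {X} f pr = begin
  ∏ₚ (suc X) f                                      ≡⟨ ∏ₚ-suc X f ⟩
  ∏ₚ X f * product (map f (filter prime? [ suc X ])) ≡⟨ cong (λ ps → ∏ₚ X f * product (map f ps)) (filter-accept prime? pr) ⟩
  ∏ₚ X f * (f (suc X) * 1)                          ≡⟨ cong (∏ₚ X f *_) (*-identityʳ (f (suc X))) ⟩
  ∏ₚ X f * f (suc X)                                ∎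
  where open ≡-Reasoning

∏ₚ-suc-nonprime : ∀ {X} (f : ℕ → ℕ) → ¬ Prime (suc X) → ∏ₚ (suc X) f ≡ ∏ₚ X f
∏ₚ-suc-nonprime {X} f ¬pr = trans (∏ₚ-suc X f)
  (trans (cong (λ ps → ∏ₚ X f * product (map f ps)) (filter-reject prime? ¬pr)) (*-identityʳ (∏ₚ X f)))

∏ₚ-prime^-nonZero : ∀ X (e : ℕ → ℕ) → NonZero (∏[ p ≤ X ] p ^ e p)
∏ₚ-prime^-nonZero X e = product-map-nonZero λ p∈ →
  m^n≢0 _ (e _) {{prime⇒nonZero (proj₁ (∈-primesUpTo⁻ {X = X} p∈))}}

∏ₚ-powers : ∀ X B E (e c : ℕ → ℕ) →
  ∏[ p ≤ X ] (p ^ E) ^ e p * B ^ c p ≡ (∏[ p ≤ X ] p ^ e p) ^ E * B ^ (∑[ p ≤ X ] c p)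
∏ₚ-powers X B E e c = begin
  ∏[ p ≤ X ] (p ^ E) ^ e p * B ^ c p
    ≡⟨ product-map-* (primesUpTo X) ⟩
  (∏[ p ≤ X ] (p ^ E) ^ e p) * (∏[ p ≤ X ] B ^ c p)
    ≡⟨ cong₂ _*_ (cong product (map-cong (λ p → ^-comm-^ p E (e p)) (primesUpTo X))) (product-map-^ʳ B (primesUpTo X)) ⟩
  (∏[ p ≤ X ] (p ^ e p) ^ E) * B ^ (∑[ p ≤ X ] c p)
    ≡⟨ cong (_* _) (product-map-^ E (primesUpTo X)) ⟩
  (∏[ p ≤ X ] p ^ e p) ^ E * B ^ (∑[ p ≤ X ] c p)
    ∎
  where open ≡-Reasoning

-- Mirrors ppart from Defs, so that ppart p M ≡ p ^ ν p M by a direct list induction.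
maxExp : ℕ → ℕ → List ℕ → ℕ
maxExp p M ks = foldr _⊔_ 0 (map (λ k → if does (p ^ k ∣? M) then k else 0) ks)

ν : ℕ → ℕ → ℕ
ν p M = maxExp p M (upTo (suc M))

private variable M : ℕ

ppart-list≡^maxExp : ∀ p .{{_ : NonZero p}} M ks →
  foldr _⊔_ 1 (map (λ k → if does (p ^ k ∣? M) then p ^ k else 1) ks) ≡ p ^ maxExp p M ks
ppart-list≡^maxExp p M []       = refl
ppart-list≡^maxExp p M (k ∷ ks) with does (p ^ k ∣? M)
... | true  = trans (cong (p ^ k ⊔_) (ppart-list≡^maxExp p M ks))
                    (sym (mono-≤-distrib-⊔ (^-monoʳ-≤ p) k (maxExp p M ks)))
... | false = trans (cong (1 ⊔_) (ppart-list≡^maxExp p M ks)) (m≤n⇒m⊔n≡n (m^n>0 p (maxExp p M ks)))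

ppart≡^ν : ∀ p .{{_ : NonZero p}} M → ppart p M ≡ p ^ ν p M
ppart≡^ν p M = ppart-list≡^maxExp p M (upTo (suc M))

^maxExp∣ : ∀ ks → p ^ maxExp p M ks ∣ M
^maxExp∣ {M = M} []       = 1∣ M
^maxExp∣ {p} {M} (k ∷ ks) with p ^ k ∣? M
... | no _ = ^maxExp∣ ks
... | yes p^k∣M with ⊔-sel k (maxExp p M ks)
...   | inj₁ ⊔≡k = subst (λ e → p ^ e ∣ M) (sym ⊔≡k) p^k∣M
...   | inj₂ ⊔≡m = subst (λ e → p ^ e ∣ M) (sym ⊔≡m) (^maxExp∣ ks)

∈∧∣⇒≤maxExp : ∀ {ks} → k ∈ ks → p ^ k ∣ M → k ≤ maxExp p M ks
∈∧∣⇒≤maxExp {k} {p} {M} {k ∷ ks} (here refl) p^k∣M with p ^ k ∣? M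
... | yes _    = m≤m⊔n k (maxExp p M ks)
... | no p^k∤M = contradiction p^k∣M p^k∤M
∈∧∣⇒≤maxExp {k} {p} {M} {j ∷ ks} (there k∈ks) p^k∣M =
  ≤-trans (∈∧∣⇒≤maxExp k∈ks p^k∣M) (m≤n⊔m (if does (p ^ j ∣? M) then j else 0) (maxExp p M ks))

^ν∣ : ∀ p M → p ^ ν p M ∣ M
^ν∣ p M = ^maxExp∣ (upTo (suc M))

∣⇒≤ν : 2 ≤ p → .{{NonZero M}} → p ^ k ∣ M → k ≤ ν p M
∣⇒≤ν {p} {M} {k} 2≤p p^k∣M = ∈∧∣⇒≤maxExp (∈-upTo⁺ (s≤s k≤M)) p^k∣M
  where
  k≤M : k ≤ M
  k≤M = <⇒≤ (<-≤-trans (n<m^n p k 2≤p) (∣⇒≤ p^k∣M))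

ν-unique : 2 ≤ p → .{{NonZero M}} → p ^ k ∣ M → ¬ p ^ suc k ∣ M → ν p M ≡ k
ν-unique {p} {M} {k} 2≤p p^k∣M p^k+1∤M = ≤-antisym ν≤k (∣⇒≤ν 2≤p p^k∣M)
  where
  ν≤k : ν p M ≤ k
  ν≤k with ν p M ≤? k
  ... | yes ν≤k = ν≤k
  ... | no  ν≰k = contradiction (∣-trans (^-monoʳ-∣ p (≰⇒> ν≰k)) (^ν∣ p M)) p^k+1∤M

ν≡suc⇒∣ : ν p M ≡ suc k → p ∣ M
ν≡suc⇒∣ {p} {M} {k} ν≡k+1 = ∣-trans (m∣m*n (p ^ k)) (subst (λ e → p ^ e ∣ M) ν≡k+1 (^ν∣ p M))

ν≡0 : .{{NonZero M}} → M < p → ν p M ≡ 0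
ν≡0 {M} {p} M<p with ν p M in ν≡
... | zero  = refl
... | suc k = contradiction (∣⇒≤ (ν≡suc⇒∣ ν≡)) (<⇒≱ M<p)

∏ₚ-ν∣ : ∀ X M → ∏[ p ≤ X ] p ^ ν p M ∣ M
∏ₚ-ν∣ zero    M = 1∣ M
∏ₚ-ν∣ (suc X) M with prime? (suc X) | ∏ₚ-ν∣ X M
... | no ¬pr | S∣M = subst (_∣ M) (sym (∏ₚ-suc-nonprime (λ p → p ^ ν p M) ¬pr)) S∣M
... | yes pr | divides T M≡TS = subst (_∣ M) (sym (∏ₚ-suc-prime (λ p → p ^ ν p M) pr)) S*p^ν∣M
  where
  S = ∏[ p ≤ X ] p ^ ν p M
  M≡ST : M ≡ S * T
  M≡ST = trans M≡TS (*-comm T S)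
  p^ν∣T : suc X ^ ν (suc X) M ∣ T
  p^ν∣T = prime^∣*⇒prime^∣ʳ (ν (suc X) M) T pr
    (prime∤∏-prime^ (λ p → ν p M) (primesUpTo X) pr
      (λ p∈ → let prp , p≤X = ∈-primesUpTo⁻ p∈ in prp , <⇒≢ (s≤s p≤X)))
    (subst (suc X ^ ν (suc X) M ∣_) M≡ST (^ν∣ (suc X) M))
  S*p^ν∣M : S * suc X ^ ν (suc X) M ∣ M
  S*p^ν∣M = subst (S * suc X ^ ν (suc X) M ∣_) (sym M≡ST) (*-monoʳ-∣ S p^ν∣T)

-- A cofactor R ≥ 2 would have a prime factor q ≤ X, and then q ^ (ν q M + 1) ∣ M.
∏ₚ-ν : .{{NonZero M}} → M ≤ X → ∏[ p ≤ X ] p ^ ν p M ≡ M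
∏ₚ-ν {M} {X} M≤X = S≡M (∏ₚ-ν∣ X M)
  where
  S = ∏[ p ≤ X ] p ^ ν p M
  S≡M : S ∣ M → S ≡ M
  S≡M (divides 0       M≡0)  = contradiction M≡0 (≢-nonZero⁻¹ M)
  S≡M (divides 1       M≡S)  = sym (trans M≡S (*-identityˡ S))
  S≡M (divides (2+ r) M≡RS) with ∃prime∣ {2+ r} (s≤s (s≤s z≤n))
  ... | q , prq , q∣R = contradiction (∣⇒≤ν (prime⇒2≤ prq) q^ν+1∣M) (1+n≰n {ν q M})
    where
    q≤X : q ≤ X
    q≤X = ≤-trans (∣⇒≤ (∣-trans q∣R (divides S (trans M≡RS (*-comm (2+ r) S))))) M≤X
    q^ν∣S : q ^ ν q M ∣ S
    q^ν∣S = ∈⇒∣product (∈-map⁺ (λ p → p ^ ν p M) (∈-primesUpTo⁺ prq q≤X))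
    q^ν+1∣M : q ^ suc (ν q M) ∣ M
    q^ν+1∣M = subst (q ^ suc (ν q M) ∣_) (sym M≡RS) (*-pres-∣ q∣R q^ν∣S)

ν-∏ₚ-prime^ : ∀ (e : ℕ → ℕ) → Prime q → q ≤ X → ν q (∏[ p ≤ X ] p ^ e p) ≡ e q
ν-∏ₚ-prime^ {q} {X} e prq q≤X with primesUpTo-pivot prq q≤X
... | ps , perm , others = ν-unique (prime⇒2≤ prq) {{∏ₚ-prime^-nonZero X e}}
  (subst (q ^ e q ∣_) (sym N≡q^e*R) (m∣m*n R)) q^e+1∤N
  where
  instance _ = m^n≢0 q (e q) {{prime⇒nonZero prq}}
  R = product (map (λ p → p ^ e p) ps)
  N≡q^e*R : ∏[ p ≤ X ] p ^ e p ≡ q ^ e q * R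
  N≡q^e*R = product-↭ (↭.map⁺ (λ p → p ^ e p) perm)
  q^e+1∤N : ¬ q ^ suc (e q) ∣ ∏[ p ≤ X ] p ^ e p
  q^e+1∤N q^e+1∣N = prime∤∏-prime^ e ps prq others (*-cancelˡ-∣ (q ^ e q)
    (subst₂ _∣_ (*-comm q (q ^ e q)) N≡q^e*R q^e+1∣N))

ℓ-pow : ℕ → ℕ → ℕ
ℓ-pow p zero    = 0
ℓ-pow p (suc k) = p ^ suc k

-- The left-hand side is the summand of ℓ M in Defs.
ℓ-summand≡ℓ-pow : Prime p → .{{NonZero M}} →
  (if does (p ∣? M) then ppart p M else 0) ≡ ℓ-pow p (ν p M)
ℓ-summand≡ℓ-pow {p} {M} prp with p ∣? M | ν p M in ν≡
... | yes p∣M | zero  =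
  contradiction (subst (1 ≤_) ν≡ (∣⇒≤ν (prime⇒2≤ prp) (subst (_∣ M) (sym (*-identityʳ p)) p∣M))) (λ ())
... | yes _   | suc k = trans (ppart≡^ν p {{prime⇒nonZero prp}} M) (cong (p ^_) ν≡)
... | no _    | zero  = refl
... | no p∤M  | suc k = contradiction (ν≡suc⇒∣ ν≡) p∤M

ℓ≡∑ₚ : .{{NonZero M}} → M ≤ X → ℓ M ≡ ∑[ p ≤ X ] ℓ-pow p (ν p M)
ℓ≡∑ₚ {M} {X} M≤X = begin
  ℓ M                             ≡⟨ cong sum (map-cong-∈ (λ p∈ → ℓ-summand≡ℓ-pow (proj₁ (∈-primesUpTo⁻ {X = M} p∈)))) ⟩
  ∑[ p ≤ M ] ℓ-pow p (ν p M)     ≡⟨ ∑ₚ-extend M≤X (λ _ M<p → cong (ℓ-pow _) (ν≡0 M<p)) ⟨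
  ∑[ p ≤ X ] ℓ-pow p (ν p M)     ∎
  where open ≡-Reasoning

Δ : ℕ → ℕ → ℕ
Δ p j = ℓ-pow p (suc j) ∸ ℓ-pow p j

ℓ-pow-suc : ∀ p .{{_ : NonZero p}} j → ℓ-pow p (suc j) ≡ ℓ-pow p j + Δ p j
ℓ-pow-suc p j = sym (m+[n∸m]≡n (ℓ-pow-mono j))
  where
  ℓ-pow-mono : ∀ j → ℓ-pow p j ≤ ℓ-pow p (suc j)
  ℓ-pow-mono zero    = z≤n
  ℓ-pow-mono (suc j) = ^-monoʳ-≤ p (n≤1+n (suc j))

Δ-zero : ∀ p → Δ p 0 ≡ p
Δ-zero p = *-identityʳ p

Δ-step : 2 ≤ p → ∀ j → Δ p j ≤ Δ p (suc j)
Δ-step {p} 2≤p zero = subst (p * 1 ≤_) (*-distribˡ-∸ p (p * 1) 1)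
  (*-monoʳ-≤ p (m+n≤o⇒m≤o∸n 1 (subst (2 ≤_) (sym (*-identityʳ p)) 2≤p)))
Δ-step {p} 2≤p (suc j) = subst (Δ p (suc j) ≤_) (*-distribˡ-∸ p (p ^ suc (suc j)) (p ^ suc j))
  (m≤n*m (Δ p (suc j)) p {{>-nonZero (<-trans z<s 2≤p)}})

Δ-mono-≤ : 2 ≤ p → j ≤ k → Δ p j ≤ Δ p k
Δ-mono-≤ {p} {j} 2≤p j≤k = go (≤⇒≤′ j≤k)
  where
  go : ∀ {k} → j ≤′ k → Δ p j ≤ Δ p k
  go ≤′-refl         = ≤-refl
  go (≤′-step {k} le) = ≤-trans (go le) (Δ-step 2≤p k)

IsAlpha⇒1≤ : ∀ {P p i} → IsAlpha P p i → 1 ≤ i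
IsAlpha⇒1≤ (inj₁ (refl , _))  = ≤-refl
IsAlpha⇒1≤ (inj₂ (2≤i , _))   = <-trans z<s 2≤i

module _ {P : ℕ} .{{_ : NonZero P}} where

  IsAlpha⇒below : ∀ {p i j} → 4 ≤ P → Prime p → p ≤ P → IsAlpha P p i → j < i → P ^ Δ p j ≤ p ^ P
  IsAlpha⇒below {p} {j = zero} 4≤P prp p≤P (inj₁ (refl , _)) _ =
    subst (λ e → P ^ e ≤ p ^ P) (sym (Δ-zero p)) (n^m≤m^n p P (prime⇒2≤ prp) p≤P 4≤P)
  IsAlpha⇒below {j = suc _} _ _ _ (inj₁ (refl , _)) (s≤s ())
  IsAlpha⇒below {p} {j = j} 4≤P prp p≤P (inj₂ (s≤s (s≤s _) , below , _)) j<i =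
    ≤-trans (^-monoʳ-≤ P (Δ-mono-≤ (prime⇒2≤ prp) (≤-pred j<i))) below

  IsAlpha⇒above : ∀ {p i j} → Prime p → IsAlpha P p i → i ≤ j → p ^ P ≤ P ^ Δ p j
  IsAlpha⇒above {p} {j = j} prp (inj₁ (refl , above)) 1≤j = ≤-trans
    (<⇒≤ (subst (λ e → p ^ P < P ^ (p ^ 2 ∸ e)) (sym (*-identityʳ p)) above))
    (^-monoʳ-≤ P (Δ-mono-≤ (prime⇒2≤ prp) 1≤j))
  IsAlpha⇒above {p} prp (inj₂ (s≤s (s≤s _) , _ , above)) i≤j =
    ≤-trans (<⇒≤ above) (^-monoʳ-≤ P (Δ-mono-≤ (prime⇒2≤ prp) i≤j))

  above-P : ∀ {p} j → 3 ≤ P → P < p → p ^ P ≤ P ^ Δ p j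
  above-P {p} j 3≤P P<p = ≤-trans (<⇒≤ (n^m<m^n P p 3≤P P<p))
    (subst (λ e → P ^ e ≤ P ^ Δ p j) (Δ-zero p) (^-monoʳ-≤ P (Δ-mono-≤ {k = j} 2≤p z≤n)))
    where
    2≤p : 2 ≤ p
    2≤p = ≤-trans (n≤1+n 2) (<-trans 3≤P P<p)

  -- If pq > P, then either q > P and P^P < P^q ≤ P^(pq - q), or q ≤ P and
  -- (pq)^P < P^(pq) = P^(pq - q) P^q with P^q ≤ q^P; both contradict P^(pq - q) ≤ p^P ≤ P^P.
  ^[pq∸q]≤⇒pq≤ : ∀ {p q} → 5 ≤ P → 2 ≤ p → p ≤ P → 2 ≤ q → P ^ (p * q ∸ q) ≤ p ^ P → p * q ≤ P
  ^[pq∸q]≤⇒pq≤ {p} {q} 5≤P 2≤p p≤P 2≤q below with p * q ≤? P | q ≤? P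
  ... | yes pq≤P | _       = pq≤P
  ... | no  pq≰P | no q≰P  = contradiction (begin-strict
    P ^ P     <⟨ ^-monoʳ-< P (≤-trans (s≤s (s≤s z≤n)) 3≤P) (n<1+n P) ⟩
    P ^ suc P ≤⟨ ^-monoʳ-≤ P (≰⇒> q≰P) ⟩
    P ^ q     ≤⟨ ^-monoʳ-≤ P q≤pq∸q ⟩
    P ^ (p * q ∸ q) ≤⟨ below ⟩
    p ^ P     ≤⟨ ^-monoˡ-≤ P p≤P ⟩
    P ^ P     ∎) (<-irrefl refl)
    where
    open ≤-Reasoning
    3≤P : 3 ≤ P
    3≤P = ≤-trans (s≤s (s≤s (s≤s z≤n))) 5≤P
    q≤pq∸q : q ≤ p * q ∸ q
    q≤pq∸q = m+n≤o⇒m≤o∸n q (subst (_≤ p * q) (cong (q +_) (+-identityʳ q)) (*-monoˡ-≤ q 2≤p))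
  ... | no  pq≰P | yes q≤P = contradiction (begin-strict
    p ^ P * P ^ q           ≤⟨ *-monoʳ-≤ (p ^ P) (n^m≤m^n q P 2≤q q≤P (≤-trans (n≤1+n 4) 5≤P)) ⟩
    p ^ P * q ^ P           ≡⟨ ^-distribʳ-* p q P ⟨
    (p * q) ^ P             <⟨ n^m<m^n P (p * q) 3≤P (≰⇒> pq≰P) ⟩
    P ^ (p * q)             ≡⟨ cong (P ^_) (m∸n+n≡m q≤pq) ⟨
    P ^ (p * q ∸ q + q)     ≡⟨ ^-distribˡ-+-* P (p * q ∸ q) q ⟩
    P ^ (p * q ∸ q) * P ^ q ≤⟨ *-monoˡ-≤ (P ^ q) below ⟩
    p ^ P * P ^ q           ∎) (<-irrefl refl)
    where
    open ≤-Reasoning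
    3≤P : 3 ≤ P
    3≤P = ≤-trans (s≤s (s≤s (s≤s z≤n))) 5≤P
    q≤pq : q ≤ p * q
    q≤pq = m≤n*m q p {{>-nonZero (<-trans z<s 2≤p)}}

  IsAlpha⇒p^i≤P : ∀ {p i} → 5 ≤ P → Prime p → p ≤ P → IsAlpha P p i → p ^ i ≤ P
  IsAlpha⇒p^i≤P {p} 5≤P prp p≤P (inj₁ (refl , _)) = subst (_≤ P) (sym (*-identityʳ p)) p≤P
  IsAlpha⇒p^i≤P {p} {suc (suc k)} 5≤P prp p≤P (inj₂ (s≤s (s≤s _) , below , _)) =
    ^[pq∸q]≤⇒pq≤ 5≤P (prime⇒2≤ prp) p≤P 2≤p^[1+k] below
    where
    2≤p^[1+k] : 2 ≤ p ^ suc k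
    2≤p^[1+k] = ≤-trans (prime⇒2≤ prp) (m≤m*n p (p ^ k) {{m^n≢0 p k {{prime⇒nonZero prp}}}})

module Proposition4 {P : ℕ} (5≤P : 5 ≤ P) {α : ℕ → ℕ}
                    (isα : (p : ℕ) → Prime p → p ≤ P → IsAlpha P p (α p)) where

  instance _ = >-nonZero (<-trans z<s 5≤P)

  α⁺ : ℕ → ℕ
  α⁺ p with p ≤? P
  ... | yes _ = α p
  ... | no  _ = 0

  α⁺-≤ : p ≤ P → α⁺ p ≡ α p
  α⁺-≤ {p} p≤P with p ≤? P
  ... | yes _   = refl
  ... | no  p≰P = contradiction p≤P p≰P

  α⁺-> : P < p → α⁺ p ≡ 0
  α⁺-> {p} P<p with p ≤? P
  ... | yes p≤P = contradiction p≤P (<⇒≱ P<p)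
  ... | no  _   = refl

  NP≡∏ₚ : P ≤ X → NP P α ≡ ∏[ p ≤ X ] p ^ α⁺ p
  NP≡∏ₚ P≤X = trans
    (cong product (map-cong-∈ (λ p∈ → cong (_ ^_) (sym (α⁺-≤ (proj₂ (∈-primesUpTo⁻ {X = P} p∈)))))))
    (sym (∏ₚ-extend P≤X (λ _ P<p → cong (_ ^_) (α⁺-> P<p))))

  nP≡∑ₚ : P ≤ X → nP P α ≡ ∑[ p ≤ X ] ℓ-pow p (α⁺ p)
  nP≡∑ₚ P≤X = trans
    (cong sum (map-cong-∈ (λ p∈ → let prp , p≤P = ∈-primesUpTo⁻ {X = P} p∈ in
      trans (^≡ℓ-pow (IsAlpha⇒1≤ (isα _ prp p≤P))) (cong (ℓ-pow _) (sym (α⁺-≤ p≤P))))))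
    (sym (∑ₚ-extend P≤X (λ _ P<p → cong (ℓ-pow _) (α⁺-> P<p))))
    where
    ^≡ℓ-pow : ∀ {p k} → 1 ≤ k → p ^ k ≡ ℓ-pow p k
    ^≡ℓ-pow {k = suc k} _ = refl

  below : Prime p → j < α⁺ p → P ^ Δ p j ≤ p ^ P
  below {p} {j} prp j<α⁺ = by-cases (p ≤? P)
    where
    by-cases : Dec (p ≤ P) → P ^ Δ p j ≤ p ^ P
    by-cases (yes p≤P) =
      IsAlpha⇒below (≤-trans (n≤1+n 4) 5≤P) prp p≤P (isα p prp p≤P) (subst (j <_) (α⁺-≤ p≤P) j<α⁺)
    by-cases (no  p≰P) = contradiction (subst (j <_) (α⁺-> (≰⇒> p≰P)) j<α⁺) λ ()

  above : Prime p → α⁺ p ≤ j → p ^ P ≤ P ^ Δ p j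
  above {p} {j} prp α⁺≤j = by-cases (p ≤? P)
    where
    by-cases : Dec (p ≤ P) → p ^ P ≤ P ^ Δ p j
    by-cases (yes p≤P) = IsAlpha⇒above prp (isα p prp p≤P) (subst (_≤ j) (α⁺-≤ p≤P) α⁺≤j)
    by-cases (no  p≰P) = above-P j (≤-trans (s≤s (s≤s (s≤s z≤n))) 5≤P) (≰⇒> p≰P)

  local-exchange : Prime p → ∀ e → (p ^ P) ^ e * P ^ ℓ-pow p (α⁺ p) ≤ (p ^ P) ^ α⁺ p * P ^ ℓ-pow p e
  local-exchange {p} prp e = exchange (p ^ P) (λ j → P ^ ℓ-pow p j) (α⁺ p) e
    (λ j j<α⁺ → subst (_≤ p ^ P * P ^ ℓ-pow p j) (sym (P^ℓ-pow-suc j)) (*-monoˡ-≤ _ (below prp j<α⁺)))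
    (λ j α⁺≤j → subst (p ^ P * P ^ ℓ-pow p j ≤_) (sym (P^ℓ-pow-suc j)) (*-monoˡ-≤ _ (above prp α⁺≤j)))
    where
    P^ℓ-pow-suc : ∀ j → P ^ ℓ-pow p (suc j) ≡ P ^ Δ p j * P ^ ℓ-pow p j
    P^ℓ-pow-suc j = begin
      P ^ ℓ-pow p (suc j)          ≡⟨ cong (P ^_) (ℓ-pow-suc p {{prime⇒nonZero prp}} j) ⟩
      P ^ (ℓ-pow p j + Δ p j)      ≡⟨ ^-distribˡ-+-* P (ℓ-pow p j) (Δ p j) ⟩
      P ^ ℓ-pow p j * P ^ Δ p j    ≡⟨ *-comm (P ^ ℓ-pow p j) (P ^ Δ p j) ⟩
      P ^ Δ p j * P ^ ℓ-pow p j    ∎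
      where open ≡-Reasoning

  M^P*P^nP≤NP^P*P^ℓM : .{{NonZero M}} → M ≤ X → P ≤ X → M ^ P * P ^ nP P α ≤ NP P α ^ P * P ^ ℓ M
  M^P*P^nP≤NP^P*P^ℓM {M} {X} M≤X P≤X = begin
    M ^ P * P ^ nP P α
      ≡⟨ cong₂ (λ a b → a ^ P * P ^ b) (sym (∏ₚ-ν M≤X)) (nP≡∑ₚ P≤X) ⟩
    (∏[ p ≤ X ] p ^ ν p M) ^ P * P ^ (∑[ p ≤ X ] ℓ-pow p (α⁺ p))
      ≡⟨ ∏ₚ-powers X P P (λ p → ν p M) (λ p → ℓ-pow p (α⁺ p)) ⟨
    ∏[ p ≤ X ] (p ^ P) ^ ν p M * P ^ ℓ-pow p (α⁺ p)
      ≤⟨ product-map-mono-≤ (λ p∈ → local-exchange (proj₁ (∈-primesUpTo⁻ {X = X} p∈)) (ν _ M)) ⟩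
    ∏[ p ≤ X ] (p ^ P) ^ α⁺ p * P ^ ℓ-pow p (ν p M)
      ≡⟨ ∏ₚ-powers X P P α⁺ (λ p → ℓ-pow p (ν p M)) ⟩
    (∏[ p ≤ X ] p ^ α⁺ p) ^ P * P ^ (∑[ p ≤ X ] ℓ-pow p (ν p M))
      ≡⟨ cong₂ (λ a b → a ^ P * P ^ b) (NP≡∏ₚ P≤X) (ℓ≡∑ₚ M≤X) ⟨
    NP P α ^ P * P ^ ℓ M
      ∎
    where open ≤-Reasoning

  NP-maximal : ∀ M → ℓ M ≤ nP P α → M ≤ NP P α
  NP-maximal zero      _       = z≤n
  NP-maximal M@(suc _) ℓM≤nP = ^-cancelʳ-≤ P (*-cancelʳ-≤ (M ^ P) (NP P α ^ P) (P ^ nP P α) {{m^n≢0 P (nP P α)}}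
    (≤-trans (M^P*P^nP≤NP^P*P^ℓM (m≤m+n M P) (m≤n+m P M)) (*-monoʳ-≤ (NP P α ^ P) (^-monoʳ-≤ P ℓM≤nP))))

  ℓ-NP : ℓ (NP P α) ≡ nP P α
  ℓ-NP = via (m≤m+n (NP P α) P) (m≤n+m P (NP P α))
    where
    instance _ = ∏ₚ-prime^-nonZero P α
    via : NP P α ≤ X → P ≤ X → ℓ (NP P α) ≡ nP P α
    via {X} N≤X P≤X = begin
      ℓ (NP P α)                      ≡⟨ ℓ≡∑ₚ N≤X ⟩
      ∑[ p ≤ X ] ℓ-pow p (ν p (NP P α)) ≡⟨ cong sum (map-cong-∈ (cong (ℓ-pow _) ∘ ν-NP)) ⟩
      ∑[ p ≤ X ] ℓ-pow p (α⁺ p)       ≡⟨ nP≡∑ₚ P≤X ⟨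
      nP P α                          ∎
      where
      open ≡-Reasoning
      ν-NP : p ∈ primesUpTo X → ν p (NP P α) ≡ α⁺ p
      ν-NP p∈ = let prp , p≤X = ∈-primesUpTo⁻ {X = X} p∈ in
        trans (cong (ν _) (NP≡∏ₚ P≤X)) (ν-∏ₚ-prime^ α⁺ prp p≤X)

  expθ≤NP : expθ P ≤ NP P α
  expθ≤NP = subst (_≤ NP P α) (cong product (map-id (primesUpTo P)))
    (product-map-mono-≤ λ {p} p∈ → let prp , p≤P = ∈-primesUpTo⁻ {X = P} p∈ in
      subst (_≤ p ^ α p) (*-identityʳ p) (^-monoʳ-≤ p {{prime⇒nonZero prp}} (IsAlpha⇒1≤ (isα p prp p≤P))))

  NP≤expψ : NP P α ≤ expψ P
  NP≤expψ = product-map-mono-≤ λ {p} p∈ → let prp , p≤P = ∈-primesUpTo⁻ {X = P} p∈ in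
    ^-monoʳ-≤ p {{prime⇒nonZero prp}} (α≤count prp (IsAlpha⇒p^i≤P 5≤P prp p≤P (isα p prp p≤P)))
    where
    α≤count : Prime p → p ^ α p ≤ P → α p ≤ length (filter (λ m → p ^ suc m ≤? P) (upTo P))
    α≤count {p} prp p^α≤P = ≤length-filter-upTo (λ m → p ^ suc m ≤? P)
      (≤-trans (<⇒≤ (n<m^n p (α p) (prime⇒2≤ prp))) p^α≤P)
      (λ m m<α → ≤-trans (^-monoʳ-≤ p {{prime⇒nonZero prp}} m<α) p^α≤P)

proposition4 : (P : ℕ) → Prime P → 5 ≤ P
    → (α : ℕ → ℕ) → ((p : ℕ) → Prime p → p ≤ P → IsAlpha P p (α p))
    → IsLandauValue (nP P α) (NP P α) × expθ P ≤ NP P α × NP P α ≤ expψ P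
proposition4 P _ 5≤P α isα = (≤-reflexive ℓ-NP , NP-maximal) , expθ≤NP , NP≤expψ
  where open Proposition4 5≤P isα
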